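{- For all integers $t\ge 3$ and $k\ge \frac t2$, $$\mathrm{rl}_k(D(1,t))\ge \frac t2 k^2-P(t)k+Q(t),$$ where $P(t)=\frac{t^2}{2}-t+\frac12$ and $Q(t)=\frac{t^3}{8}-\frac{t^2}{2}+\frac{3t}{4}-\frac12$.
   Context: For a finite set $D=\{d_1<\dots<d_m\}$ of positive integers, the distance graph $D(d_1,\dots,d_m)$ has vertex set $\mathbb{Z}$, two distinct integers $i,j$ being adjacent iff $|i-j|\in D$. For a connected graph $G$ with graph distance $d(\cdot,\cdot)$ and an integer $k\ge 1$, a radio $k$-labeling of $G$ is a map $c:V(G)\to\mathbb{Z}_{\ge 0}$ such that $|c(u)-c(v)|\geq k+1-d(u,v)$ for all distinct vertices $u,v$. Its span is $\max\{c(x)-c(y): x,y\in V(G)\}$ (a supremum for infinite graphs), and the radio $k$-labeling number $\mathrm{rl}_k(G)$ is the minimum span over all radio $k$-labelings of $G$. -}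

module Defs where

open import Data.Nat using (ℕ; zero; suc; _+_; _≤_)
open import Data.Integer as ℤ using (ℤ; ∣_∣)
open import Data.Product using (_×_)
open import Data.Sum using (_⊎_)
open import Relation.Binary.PropositionalEquality using (_≡_; _≢_)
import Data.Nat as ℕ

Adj : ℕ → ℤ → ℤ → Set
Adj t i j = (∣ i ℤ.- j ∣ ≡ 1) ⊎ (∣ i ℤ.- j ∣ ≡ t)

data Walk (t : ℕ) : ℤ → ℤ → ℕ → Set where
  here : ∀ {u} → Walk t u u 0
  step : ∀ {u w v n} → Adj t u w → Walk t w v n → Walk t u v (suc n)

IsDist : ℕ → ℤ → ℤ → ℕ → Set
IsDist t u v n = Walk t u v n × (∀ m → Walk t u v m → n ≤ m)

-- Radio k-labeling of D(1,t): c : ℤ → ℕ with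
-- |c(u) - c(v)| ≥ k + 1 - d(u,v) for all distinct u, v
-- (written without truncated subtraction as |c u - c v| + d ≥ k + 1).
IsRadioLabeling : ℕ → ℕ → (ℤ → ℕ) → Set
IsRadioLabeling t k c =
  ∀ u v → u ≢ v → ∀ d → IsDist t u v d → suc k ≤ ℕ.∣ c u - c v ∣ + d

-- Let reach v be the length of the walk from 0 to v that makes q jumps of length t and then
-- unit steps, forwards or backwards, whichever is shorter.  Since d(u,v) ≤ reach u + reach v,
-- a radio k-labeling c satisfies |c u − c v| ≥ k + 1 − reach u − reach v.  Give each vertex v
-- with 2 reach v ≤ k + 1 the weight w v = k + 1 − 2 reach v.  Listed by increasing label,
-- consecutive such vertices have labels at least (w u + w v)/2 apart, so by telescoping the
-- span of c is at least Σ w − k.  Summing w over [−Qt, Qt] block by block gives total t Q (k+1);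
-- passing from (k, Q) to (k + 2, Q + 1) increases 8 (total − k) by at least
-- 16 t (k + 3) − 8 (t + 1)², exactly the increment of the bound, and when 2k ≤ t ≤ 2k + 3 a
-- single block already beats the bound.
module Submission where

open import Defs
open import Data.Nat as ℕ using (ℕ; zero; suc; _≤_; _<_; z≤n; s≤s; _+_; _*_; _∸_; _⊓_; _/_; _%_; NonZero)
import Data.Nat.Properties as ℕP
open import Data.Nat.Induction using (<-rec)
import Data.Nat.DivMod as DM
open import Data.Nat.Divisibility using (divides-refl)
open import Data.Nat.ListAction using (sum)
open import Data.Nat.ListAction.Properties using (sum-↭; sum-++)
import Data.Nat.Tactic.RingSolver as ℕ-Solver
open import Data.Integer as ℤ using (ℤ; +_; -[1+_]; ∣_∣)
import Data.Integer.Properties as ℤP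
import Data.Integer.Tactic.RingSolver as ℤ-Solver
open import Data.List using (List; []; _∷_; _++_; map; length; filter; applyUpTo)
import Data.List.Properties as ListP
open import Data.List.Relation.Unary.Any using (here; there; any?)
open import Data.List.Relation.Unary.All as All using (All; []; _∷_)
open import Data.List.Relation.Unary.All.Properties using (all-filter)
open import Data.List.Relation.Unary.AllPairs using ([]; _∷_)
open import Data.List.Relation.Unary.Linked using (Linked; []; [-]; _∷_)
open import Data.List.Relation.Unary.Unique.Propositional using (Unique)
import Data.List.Relation.Unary.Unique.Propositional.Properties as UniqueP
open import Data.List.Membership.Propositional using (_∈_; find; lose)
open import Data.List.Membership.Propositional.Properties using (∈-filter⁺; ∈-++⁺ˡ; ∈-applyUpTo⁺; ∈-applyUpTo⁻)
open import Data.List.Relation.Binary.Permutation.Propositional using (↭-sym; ↭⇒↭ₛ)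
open import Data.List.Relation.Binary.Permutation.Propositional.Properties using (All-resp-↭; ↭-length; map⁺)
import Data.List.Relation.Binary.Permutation.Setoid.Properties as SetoidPermutation
import Data.List.Sort as Sort
open import Data.Product using (_×_; _,_; ∃₂; ∃-syntax)
open import Data.Sum using (_⊎_; inj₁; inj₂)
import Data.Sum
open import Data.Empty using (⊥-elim)
open import Function using (case_of_)
open import Relation.Nullary using (Dec; yes; no; ¬_)
open import Relation.Nullary.Decidable using (map′)
open import Relation.Unary using (Decidable)
import Relation.Binary.Construct.On as On
open import Relation.Binary.PropositionalEquality

least-witness : {P : ℕ → Set} → Decidable P → ∀ m → P m → ∃[ n ] P n × (∀ j → P j → n ≤ j)
least-witness P? = <-rec _ λ m rec pm → case ℕP.anyUpTo? P? m of λ where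
  (yes (j , j<m , pj)) → rec j<m pj
  (no none) → m , pm , λ j pj → ℕP.≮⇒≥ λ j<m → none (j , j<m , pj)

∣u-[u+d]∣ : ∀ u d → ∣ u ℤ.- (u ℤ.+ d) ∣ ≡ ∣ d ∣
∣u-[u+d]∣ u d = trans (cong ∣_∣ (cancel u d)) (ℤP.∣-i∣≡∣i∣ d)
  where
  cancel : ∀ u d → u ℤ.- (u ℤ.+ d) ≡ ℤ.- d
  cancel = ℤ-Solver.solve-∀

∣i∣≡n⇒i≡±n : ∀ i {n} → ∣ i ∣ ≡ n → i ≡ + n ⊎ i ≡ ℤ.- + n
∣i∣≡n⇒i≡±n (+ m) refl = inj₁ refl
∣i∣≡n⇒i≡±n -[1+ m ] refl = inj₂ refl

i-j≡k⇒i≡j+k : ∀ {i j k} → i ℤ.- j ≡ k → i ≡ j ℤ.+ k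
i-j≡k⇒i≡j+k {i} {j} refl = identity i j
  where
  identity : ∀ i j → i ≡ j ℤ.+ (i ℤ.- j)
  identity = ℤ-Solver.solve-∀

module _ {t : ℕ} where

  adj-sym : ∀ u v → Adj t u v → Adj t v u
  adj-sym u v = Data.Sum.map (trans (ℤP.∣i-j∣≡∣j-i∣ v u)) (trans (ℤP.∣i-j∣≡∣j-i∣ v u))

  adj-neg : ∀ u v → Adj t u v → Adj t (ℤ.- u) (ℤ.- v)
  adj-neg u v = Data.Sum.map (trans mirrored) (trans mirrored)
    where
    mirrored : ∣ ℤ.- u ℤ.- ℤ.- v ∣ ≡ ∣ u ℤ.- v ∣
    mirrored = trans (cong ∣_∣ (neg-distrib u v)) (ℤP.∣-i∣≡∣i∣ (u ℤ.- v))
      where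
      neg-distrib : ∀ u v → ℤ.- u ℤ.- ℤ.- v ≡ ℤ.- (u ℤ.- v)
      neg-distrib = ℤ-Solver.solve-∀

  snoc : ∀ {u w v n} → Walk t u w n → Adj t w v → Walk t u v (suc n)
  snoc here a = step a here
  snoc (step b w) a = step b (snoc w a)

  reverse : ∀ {u v n} → Walk t u v n → Walk t v u n
  reverse here = here
  reverse (step {u} {w₁} a w) = snoc (reverse w) (adj-sym u w₁ a)

  _++ʷ_ : ∀ {u w v m n} → Walk t u w m → Walk t w v n → Walk t u v (m + n)
  here ++ʷ w = w
  step a w₁ ++ʷ w₂ = step a (w₁ ++ʷ w₂)

  mirror : ∀ {u v n} → Walk t u v n → Walk t (ℤ.- u) (ℤ.- v) n
  mirror here = here
  mirror (step {u} {w₁} a w) = step (adj-neg u w₁ a) (mirror w)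

  neighbours : ℤ → List ℤ
  neighbours u = u ℤ.+ + 1 ∷ u ℤ.- + 1 ∷ u ℤ.+ + t ∷ u ℤ.- + t ∷ []

  ∈-neighbours⇒adj : ∀ u {w} → w ∈ neighbours u → Adj t u w
  ∈-neighbours⇒adj u (here refl) = inj₁ (∣u-[u+d]∣ u (+ 1))
  ∈-neighbours⇒adj u (there (here refl)) = inj₁ (∣u-[u+d]∣ u (ℤ.- + 1))
  ∈-neighbours⇒adj u (there (there (here refl))) = inj₂ (∣u-[u+d]∣ u (+ t))
  ∈-neighbours⇒adj u (there (there (there (here refl)))) =
    inj₂ (trans (∣u-[u+d]∣ u (ℤ.- + t)) (ℤP.∣-i∣≡∣i∣ (+ t)))

  adj⇒∈-neighbours : ∀ u {w} → Adj t u w → w ∈ neighbours u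
  adj⇒∈-neighbours u {w} (inj₁ ∣u-w∣≡1) with ∣i∣≡n⇒i≡±n (w ℤ.- u) (trans (ℤP.∣i-j∣≡∣j-i∣ w u) ∣u-w∣≡1)
  ... | inj₁ d = here (i-j≡k⇒i≡j+k d)
  ... | inj₂ d = there (here (i-j≡k⇒i≡j+k d))
  adj⇒∈-neighbours u {w} (inj₂ ∣u-w∣≡t) with ∣i∣≡n⇒i≡±n (w ℤ.- u) (trans (ℤP.∣i-j∣≡∣j-i∣ w u) ∣u-w∣≡t)
  ... | inj₁ d = there (there (here (i-j≡k⇒i≡j+k d)))
  ... | inj₂ d = there (there (there (here (i-j≡k⇒i≡j+k d))))

  walk? : ∀ n u v → Dec (Walk t u v n)
  walk? zero u v = map′ (λ { refl → here }) (λ { here → refl }) (u ℤ.≟ v)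
  walk? (suc n) u v = map′
    (λ found → let _ , w∈ , walk = find found in step (∈-neighbours⇒adj u w∈) walk)
    (λ { (step adj walk) → lose (adj⇒∈-neighbours u adj) walk })
    (any? (λ w → walk? n w v) (neighbours u))

  walk⇒distance : ∀ {u v m} → Walk t u v m → ∃[ d ] d ≤ m × IsDist t u v d
  walk⇒distance {u} {v} {m} walk =
    let d , walk-d , minimal = least-witness (λ n → walk? n u v) m walk
    in d , minimal m walk , walk-d , minimal

radio-walk : ∀ {t k c} → IsRadioLabeling t k c → ∀ {u v m} → u ≢ v → Walk t u v m →
  suc k ≤ ℕ.∣ c u - c v ∣ + m
radio-walk {c = c} radio {u} {v} u≢v walk =
  let d , d≤m , dist = walk⇒distance walk
  in ℕP.≤-trans (radio u v u≢v d dist) (ℕP.+-monoʳ-≤ ℕ.∣ c u - c v ∣ d≤m)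

∑ : ℕ → (ℕ → ℕ) → ℕ
∑ n f = sum (applyUpTo f n)

syntax ∑ n (λ i → e) = ∑[ i < n ] e

∑-cong : ∀ n {f g} → (∀ {i} → i < n → f i ≡ g i) → ∑ n f ≡ ∑ n g
∑-cong zero f≡g = refl
∑-cong (suc n) f≡g = cong₂ _+_ (f≡g (s≤s z≤n)) (∑-cong n (λ i<n → f≡g (s≤s i<n)))

∑-mono-≤ : ∀ n {f g} → (∀ {i} → i < n → f i ≤ g i) → ∑ n f ≤ ∑ n g
∑-mono-≤ zero f≤g = z≤n
∑-mono-≤ (suc n) f≤g = ℕP.+-mono-≤ (f≤g (s≤s z≤n)) (∑-mono-≤ n (λ i<n → f≤g (s≤s i<n)))

∑-+ : ∀ n f g → ∑[ i < n ] (f i + g i) ≡ ∑ n f + ∑ n g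
∑-+ zero f g = refl
∑-+ (suc n) f g = trans (cong (_+_ (f 0 + g 0)) (∑-+ n (λ i → f (suc i)) (λ i → g (suc i))))
  (interchange (f 0) (g 0) (∑[ i < n ] f (suc i)) (∑[ i < n ] g (suc i)))
  where
  interchange : ∀ a b c d → a + b + (c + d) ≡ a + c + (b + d)
  interchange = ℕ-Solver.solve-∀

∑-const : ∀ n a → ∑[ i < n ] a ≡ n * a
∑-const zero a = refl
∑-const (suc n) a = cong (_+_ a) (∑-const n a)

∑-*ˡ : ∀ n a f → ∑[ i < n ] (a * f i) ≡ a * ∑ n f
∑-*ˡ zero a f = sym (ℕP.*-zeroʳ a)
∑-*ˡ (suc n) a f = trans (cong (_+_ (a * f 0)) (∑-*ˡ n a (λ i → f (suc i))))
  (sym (ℕP.*-distribˡ-+ a (f 0) _))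

∑-++ : ∀ m n f → ∑ (m + n) f ≡ ∑ m f + ∑[ i < n ] f (m + i)
∑-++ zero n f = refl
∑-++ (suc m) n f = trans (cong (_+_ (f 0)) (∑-++ m n (λ i → f (suc i)))) (sym (ℕP.+-assoc (f 0) _ _))

∑-blocks : ∀ Q t f → ∑ (Q * t) f ≡ ∑[ q < Q ] ∑[ r < t ] f (r + q * t)
∑-blocks zero t f = refl
∑-blocks (suc Q) t f = trans (∑-++ t (Q * t) f) (cong₂ _+_
  (∑-cong t (λ {r} _ → cong f (sym (ℕP.+-identityʳ r))))
  (trans (∑-blocks Q t (λ i → f (t + i)))
    (∑-cong Q (λ {q} _ → ∑-cong t (λ {r} _ → cong f (shift t r (q * t)))))))
  where
  shift : ∀ t r s → t + (r + s) ≡ r + (t + s)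
  shift = ℕ-Solver.solve-∀

∑-suc : ∀ n f → ∑ (suc n) f ≡ ∑ n f + f n
∑-suc n f = trans (cong (λ m → ∑ m f) (ℕP.+-comm 1 n))
  (trans (∑-++ n 1 f) (cong (λ x → ∑ n f + x) (trans (ℕP.+-identityʳ _) (cong f (ℕP.+-identityʳ n)))))

residueCost : ℕ → ℕ → ℕ
residueCost t r = suc r ⊓ (t ∸ r)

∑-residueCost : ∀ t → 4 * ∑[ r < t ] residueCost t r ≤ suc t * suc t
∑-residueCost zero = z≤n
∑-residueCost (suc zero) = ℕP.≤-refl
∑-residueCost (suc (suc t)) = begin
  4 * (1 + ∑[ r < suc t ] residueCost (2 + t) (suc r))  ≡⟨ cong (λ x → 4 * (1 + x)) inner ⟩
  4 * (1 + (suc t + (S + 0)))                          ≡⟨ expand t S ⟩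
  4 * S + 4 * t + 8                                    ≤⟨ ℕP.+-monoˡ-≤ 8 (ℕP.+-monoˡ-≤ (4 * t) (∑-residueCost t)) ⟩
  suc t * suc t + 4 * t + 8                            ≡⟨ square t ⟩
  suc (suc (suc t)) * suc (suc (suc t))                ∎
  where
  open ℕP.≤-Reasoning
  S = ∑[ r < t ] residueCost t r
  shifted : ∀ {r} → r < suc t → residueCost (2 + t) (suc r) ≡ 1 + residueCost t r
  shifted {r} (s≤s r≤t) = cong (suc (suc r) ⊓_) (ℕP.+-∸-assoc 1 r≤t)
  last : residueCost t t ≡ 0
  last = trans (cong (suc t ⊓_) (ℕP.n∸n≡0 t)) (ℕP.⊓-zeroʳ (suc t))
  inner : ∑[ r < suc t ] residueCost (2 + t) (suc r) ≡ suc t + (S + 0)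
  inner = trans (∑-cong (suc t) shifted) (trans (∑-+ (suc t) (λ _ → 1) (residueCost t))
    (cong₂ _+_ (trans (∑-const (suc t) 1) (ℕP.*-identityʳ (suc t)))
               (trans (∑-suc t (residueCost t)) (cong (_+_ S) last))))
  expand : ∀ t S → 4 * (1 + (suc t + (S + 0))) ≡ 4 * S + 4 * t + 8
  expand = ℕ-Solver.solve-∀
  square : ∀ t → suc t * suc t + 4 * t + 8 ≡ suc (suc (suc t)) * suc (suc (suc t))
  square = ℕ-Solver.solve-∀

module _ (t : ℕ) .{{_ : NonZero t}} where

  adj-up : ∀ a {d} → d ≡ 1 ⊎ d ≡ t → Adj t (+ a) (+ (a + d))
  adj-up a (inj₁ refl) = inj₁ (∣u-[u+d]∣ (+ a) (+ 1))
  adj-up a (inj₂ refl) = inj₂ (∣u-[u+d]∣ (+ a) (+ t))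

  ascend : ∀ {d} → d ≡ 1 ⊎ d ≡ t → ∀ n {a b} → a + n * d ≡ b → Walk t (+ a) (+ b) n
  ascend d≡1∨t zero {a} refl = subst (λ b → Walk t (+ a) (+ b) 0) (sym (ℕP.+-identityʳ a)) here
  ascend {d} d≡1∨t (suc n) {a} refl =
    step (adj-up a d≡1∨t)
         (ascend d≡1∨t n {a + d} (ℕP.+-assoc a d (n * d)))

  route-forward : ∀ q r → Walk t (+ 0) (+ suc (r + q * t)) (q + suc r)
  route-forward q r = ascend (inj₂ refl) q refl ++ʷ ascend (inj₁ refl) (suc r) (arrive q r t)
    where
    arrive : ∀ q r t → q * t + suc r * 1 ≡ suc (r + q * t)
    arrive = ℕ-Solver.solve-∀

  route-backward : ∀ q r → r < t → Walk t (+ 0) (+ suc (r + q * t)) (q + (t ∸ r))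
  route-backward q r r<t = subst (Walk t (+ 0) (+ suc (r + q * t))) steps
    (ascend (inj₂ refl) (suc q) overshoot ++ʷ reverse (ascend (inj₁ refl) (t ∸ suc r) refl))
    where
    overshoot : 0 + suc q * t ≡ suc (r + q * t) + (t ∸ suc r) * 1
    overshoot = trans (cong (λ x → x + q * t) (sym (ℕP.m+[n∸m]≡n r<t))) (arrange (suc r) (t ∸ suc r) (q * t))
      where
      arrange : ∀ a b c → a + b + c ≡ a + c + b * 1
      arrange = ℕ-Solver.solve-∀
    steps : suc q + (t ∸ suc r) ≡ q + (t ∸ r)
    steps = trans (sym (ℕP.+-suc q (t ∸ suc r))) (cong (λ x → q + x) (sym (ℕP.+-∸-assoc 1 r<t)))

  -- reach⁺ n is for the two vertices ±(n + 1).
  reach⁺ : ℕ → ℕ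
  reach⁺ n = n / t + residueCost t (n % t)

  reach : ℤ → ℕ
  reach (+ zero) = 0
  reach (+ suc n) = reach⁺ n
  reach -[1+ n ] = reach⁺ n

  block-walk : ∀ q r → r < t → Walk t (+ 0) (+ suc (r + q * t)) (q + residueCost t r)
  block-walk q r r<t with ℕP.⊓-sel (suc r) (t ∸ r)
  ... | inj₁ eq = subst (Walk t (+ 0) (+ suc (r + q * t))) (cong (λ x → q + x) (sym eq)) (route-forward q r)
  ... | inj₂ eq = subst (Walk t (+ 0) (+ suc (r + q * t))) (cong (λ x → q + x) (sym eq)) (route-backward q r r<t)

  walk-reach⁺ : ∀ n → Walk t (+ 0) (+ suc n) (reach⁺ n)
  walk-reach⁺ n = subst (λ m → Walk t (+ 0) (+ suc m) (reach⁺ n)) (sym (DM.m≡m%n+[m/n]*n n t))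
    (block-walk (n / t) (n % t) (DM.m%n<n n t))

  walk-reach : ∀ v → Walk t (+ 0) v (reach v)
  walk-reach (+ zero) = here
  walk-reach (+ suc n) = walk-reach⁺ n
  walk-reach -[1+ n ] = mirror (walk-reach⁺ n)

  reach≡0⇒origin : ∀ v → reach v ≡ 0 → v ≡ + 0
  reach≡0⇒origin v eq = sym (endpoints (subst (Walk t (+ 0) v) eq (walk-reach v)))
    where
    endpoints : ∀ {u v} → Walk t u v 0 → u ≡ v
    endpoints here = refl

  reach-block : ∀ q r → r < t → reach⁺ (r + q * t) ≡ q + residueCost t r
  reach-block q r r<t = cong₂ (λ a b → a + residueCost t b) quotient remainder
    where
    quotient : (r + q * t) / t ≡ q
    quotient = trans (DM.+-distrib-/-∣ʳ r (divides-refl q))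
                     (cong₂ _+_ (DM.m<n⇒m/n≡0 r<t) (DM.m*n/n≡m q t))
    remainder : (r + q * t) % t ≡ r
    remainder = trans (DM.[m+kn]%n≡m%n r q t) (DM.m<n⇒m%n≡m r<t)

  ∑-reach-blocks : ∀ Q (g : ℕ → ℕ) → ∑[ n < Q * t ] g (reach⁺ n) ≡ ∑[ q < Q ] ∑[ r < t ] g (q + residueCost t r)
  ∑-reach-blocks Q g = trans (∑-blocks Q t (λ n → g (reach⁺ n)))
    (∑-cong Q λ {q} _ → ∑-cong t λ {r} r<t → cong g (reach-block q r r<t))

  reach-1≤1 : reach (+ 1) ≤ 1
  reach-1≤1 = begin
    0 / t + residueCost t (0 % t) ≡⟨ cong₂ (λ a b → a + residueCost t b) (DM.0/n≡0 t) (DM.m<n⇒m%n≡m (ℕ.>-nonZero⁻¹ t)) ⟩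
    1 ⊓ t                         ≤⟨ ℕP.m⊓n≤m 1 t ⟩
    1                             ∎
    where open ℕP.≤-Reasoning

  reach-separated : ∀ {k c} → IsRadioLabeling t k c → ∀ {u v} → u ≢ v → suc k ≤ ℕ.∣ c u - c v ∣ + (reach u + reach v)
  reach-separated {c = c} radio {u} {v} u≢v = radio-walk {c = c} radio u≢v (reverse (walk-reach u) ++ʷ walk-reach v)

  reach-roots : ∀ {u v} → u ≢ v → 1 ≤ reach u + reach v
  reach-roots {u} {v} u≢v with reach u in reach-u | reach v in reach-v
  ... | suc _ | _ = s≤s z≤n
  ... | zero | suc _ = s≤s z≤n
  ... | zero | zero = ⊥-elim (u≢v (trans (reach≡0⇒origin u reach-u) (sym (reach≡0⇒origin v reach-v))))

  ball : ℕ → List ℤ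
  ball N = applyUpTo +_ (suc N) ++ applyUpTo -[1+_] N

  ball-unique : ∀ N → Unique (ball N)
  ball-unique N = UniqueP.++⁺
    (UniqueP.applyUpTo⁺₁ +_ (suc N) λ i<j _ eq → ℕP.<⇒≢ i<j (ℤP.+-injective eq))
    (UniqueP.applyUpTo⁺₁ -[1+_] N λ { i<j _ refl → ℕP.<-irrefl refl i<j })
    disjoint
    where
    disjoint : ∀ {v} → ¬ (v ∈ applyUpTo +_ (suc N) × v ∈ applyUpTo -[1+_] N)
    disjoint (v∈⁺ , v∈⁻) with ∈-applyUpTo⁻ +_ v∈⁺ | ∈-applyUpTo⁻ -[1+_] v∈⁻
    ... | _ , _ , refl | _ , _ , ()

  sum-ball : ∀ (g : ℕ → ℕ) N → sum (map (λ v → g (reach v)) (ball N)) ≡ g 0 + 2 * ∑[ n < N ] g (reach⁺ n)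
  sum-ball g N = begin
    sum (map h (applyUpTo +_ (suc N) ++ applyUpTo -[1+_] N))
      ≡⟨ cong sum (ListP.map-++ h (applyUpTo +_ (suc N)) (applyUpTo -[1+_] N)) ⟩
    sum (map h (applyUpTo +_ (suc N)) ++ map h (applyUpTo -[1+_] N))
      ≡⟨ sum-++ (map h (applyUpTo +_ (suc N))) (map h (applyUpTo -[1+_] N)) ⟩
    sum (map h (applyUpTo +_ (suc N))) + sum (map h (applyUpTo -[1+_] N))
      ≡⟨ cong₂ _+_ (cong sum (ListP.map-applyUpTo +_ h (suc N))) (cong sum (ListP.map-applyUpTo -[1+_] h N)) ⟩
    g 0 + X + X
      ≡⟨ ℕP.+-assoc (g 0) X X ⟩
    g 0 + (X + X)
      ≡⟨ cong (_+_ (g 0)) (cong (_+_ X) (sym (ℕP.+-identityʳ X))) ⟩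
    g 0 + 2 * X ∎
    where
    open ≡-Reasoning
    h : ℤ → ℕ
    h v = g (reach v)
    X : ℕ
    X = ∑[ n < N ] g (reach⁺ n)

module _ {A : Set} (c w : A → ℕ) where
  open ℕP.≤-Reasoning

  Spaced : A → A → Set
  Spaced u v = w u + w v + 2 * c u ≤ 2 * c v

  spaced-span : ∀ {x y ys} → Linked Spaced (x ∷ y ∷ ys) →
    ∃[ z ] z ∈ y ∷ ys × 2 * sum (map w (x ∷ y ∷ ys)) + 2 * c x ≤ 2 * c z + w x + w z
  spaced-span {x} {y} {[]} (x~y ∷ [-]) = y , here refl , (begin
    2 * (w x + (w y + 0)) + 2 * c x   ≡⟨ split (w x) (w y) (c x) ⟩
    (w x + w y + 2 * c x) + (w x + w y) ≤⟨ ℕP.+-monoˡ-≤ (w x + w y) x~y ⟩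
    2 * c y + (w x + w y)             ≡⟨ ℕP.+-assoc (2 * c y) (w x) (w y) ⟨
    2 * c y + w x + w y               ∎)
    where
    split : ∀ a b d → 2 * (a + (b + 0)) + 2 * d ≡ (a + b + 2 * d) + (a + b)
    split = ℕ-Solver.solve-∀
  spaced-span {x} {y} {y′ ∷ ys} (x~y ∷ y~ys) =
    let z , z∈ , chain = spaced-span y~ys
        S = sum (map w (y ∷ y′ ∷ ys))
    in z , there z∈ , ℕP.+-cancelʳ-≤ (2 * c y + w y) _ _ (begin
      2 * (w x + S) + 2 * c x + (2 * c y + w y)     ≡⟨ regroup (w x) (w y) S (c x) (c y) ⟩
      (2 * S + 2 * c y) + (w x + w y + 2 * c x) + w x ≤⟨ ℕP.+-monoˡ-≤ (w x) (ℕP.+-mono-≤ chain x~y) ⟩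
      (2 * c z + w y + w z) + 2 * c y + w x           ≡⟨ reorder (c z) (w x) (w y) (w z) (c y) ⟩
      2 * c z + w x + w z + (2 * c y + w y)           ∎)
    where
    regroup : ∀ a b s d e → 2 * (a + s) + 2 * d + (2 * e + b) ≡ (2 * s + 2 * e) + (a + b + 2 * d) + a
    regroup = ℕ-Solver.solve-∀
    reorder : ∀ f a b g e → (2 * f + b + g) + 2 * e + a ≡ 2 * f + a + g + (2 * e + b)
    reorder = ℕ-Solver.solve-∀

distinct-members⇒2≤length : ∀ {A : Set} {x y : A} {xs} → x ∈ xs → y ∈ xs → x ≢ y → 2 ≤ length xs
distinct-members⇒2≤length {xs = _ ∷ _ ∷ _} _ _ _ = s≤s (s≤s z≤n)
distinct-members⇒2≤length {xs = _ ∷ []} (here refl) (here refl) x≢y = ⊥-elim (x≢y refl)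

module Packing {A : Set} (c L : A → ℕ) (k : ℕ)
  (separated : ∀ {u v} → u ≢ v → suc k ≤ ℕ.∣ c u - c v ∣ + (L u + L v))
  (separated-roots : ∀ {u v} → u ≢ v → 1 ≤ L u + L v) where
  open ℕP.≤-Reasoning

  Near : A → Set
  Near v = 2 * L v ≤ suc k

  near? : Decidable Near
  near? v = 2 * L v ℕ.≤? suc k

  weight : A → ℕ
  weight v = suc k ∸ 2 * L v

  pair-weight : ∀ {u v} → Near u → Near v → weight u + weight v + 2 * (L u + L v) ≡ 2 * suc k
  pair-weight {u} {v} near-u near-v = begin-equality
    weight u + weight v + 2 * (L u + L v)         ≡⟨ regroup (weight u) (weight v) (L u) (L v) ⟩
    (weight u + 2 * L u) + (weight v + 2 * L v) ≡⟨ cong₂ _+_ (ℕP.m∸n+n≡m near-u) (ℕP.m∸n+n≡m near-v) ⟩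
    suc k + suc k                                 ≡⟨ double (suc k) ⟩
    2 * suc k ∎
    where
    regroup : ∀ a b l m → a + b + 2 * (l + m) ≡ (a + 2 * l) + (b + 2 * m)
    regroup = ℕ-Solver.solve-∀
    double : ∀ n → n + n ≡ 2 * n
    double = ℕ-Solver.solve-∀

  spacing : ∀ {u v} → Near u → Near v → u ≢ v → c u ≤ c v → Spaced c weight u v
  spacing {u} {v} near-u near-v u≢v cu≤cv = begin
    weight u + weight v + 2 * c u ≤⟨ ℕP.+-monoˡ-≤ (2 * c u) gap ⟩
    2 * (c v ∸ c u) + 2 * c u     ≡⟨ ℕP.*-distribˡ-+ 2 (c v ∸ c u) (c u) ⟨
    2 * (c v ∸ c u + c u)         ≡⟨ cong (2 *_) (ℕP.m∸n+n≡m cu≤cv) ⟩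
    2 * c v                       ∎
    where
    Lᵤᵥ = L u + L v
    gap : weight u + weight v ≤ 2 * (c v ∸ c u)
    gap = ℕP.+-cancelʳ-≤ (2 * Lᵤᵥ) _ _ (begin
      weight u + weight v + 2 * Lᵤᵥ  ≡⟨ pair-weight near-u near-v ⟩
      2 * suc k                      ≤⟨ ℕP.*-monoʳ-≤ 2 (subst (λ d → suc k ≤ d + Lᵤᵥ) (ℕP.m≤n⇒∣m-n∣≡n∸m cu≤cv) (separated u≢v)) ⟩
      2 * (c v ∸ c u + Lᵤᵥ)          ≡⟨ ℕP.*-distribˡ-+ 2 (c v ∸ c u) Lᵤᵥ ⟩
      2 * (c v ∸ c u) + 2 * Lᵤᵥ      ∎)

  endpoint-weights : ∀ {u v} → Near u → Near v → u ≢ v → weight u + weight v ≤ 2 * k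
  endpoint-weights {u} {v} near-u near-v u≢v = ℕP.+-cancelʳ-≤ 2 _ _ (begin
    weight u + weight v + 2                     ≤⟨ ℕP.+-monoʳ-≤ (weight u + weight v) (ℕP.*-monoʳ-≤ 2 (separated-roots u≢v)) ⟩
    weight u + weight v + 2 * (L u + L v)       ≡⟨ pair-weight near-u near-v ⟩
    2 * suc k                                   ≡⟨ trans (ℕP.*-suc 2 k) (ℕP.+-comm 2 (2 * k)) ⟩
    2 * k + 2                                   ∎)

  sum-filter-near : ∀ xs → sum (map weight (filter near? xs)) ≡ sum (map weight xs)
  sum-filter-near [] = refl
  sum-filter-near (x ∷ xs) with near? x
  ... | yes near = trans (cong (λ ys → sum (map weight ys)) (ListP.filter-accept near? {xs = xs} near))
    (cong (_+_ (weight x)) (sum-filter-near xs))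
  ... | no far = trans (cong (λ ys → sum (map weight ys)) (ListP.filter-reject near? {xs = xs} far))
    (trans (sum-filter-near xs) (cong (_+ sum (map weight xs)) (sym (ℕP.m≤n⇒m∸n≡0 (ℕP.<⇒≤ (ℕP.≰⇒> far))))))

  Ascending : List A → Set
  Ascending = Linked (λ u v → c u ≤ c v)

  ascending-spaced : ∀ {xs} → Ascending xs → Unique xs → All Near xs → Linked (Spaced c weight) xs
  ascending-spaced [] _ _ = []
  ascending-spaced [-] _ _ = [-]
  ascending-spaced (cu≤cv ∷ ascending) ((u≢v ∷ _) ∷ unique) (near-u ∷ near-v ∷ near) =
    spacing near-u near-v u≢v cu≤cv ∷ ascending-spaced ascending unique (near-v ∷ near)

  ascending-span : ∀ xs → Ascending xs → Unique xs → All Near xs → 2 ≤ length xs →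
    ∃₂ λ x z → sum (map weight xs) + c x ≤ c z + k
  ascending-span (x ∷ y ∷ ys) ascending unique@(x≢ ∷ _) near _ =
    let z , z∈ , chain = spaced-span c weight (ascending-spaced ascending unique near)
    in x , z , ℕP.*-cancelˡ-≤ 2 (begin
      2 * (sum (map weight (x ∷ y ∷ ys)) + c x)           ≡⟨ ℕP.*-distribˡ-+ 2 (sum (map weight (x ∷ y ∷ ys))) (c x) ⟩
      2 * sum (map weight (x ∷ y ∷ ys)) + 2 * c x         ≤⟨ chain ⟩
      2 * c z + weight x + weight z                        ≡⟨ ℕP.+-assoc (2 * c z) (weight x) (weight z) ⟩
      2 * c z + (weight x + weight z)                      ≤⟨ ℕP.+-monoʳ-≤ (2 * c z) (endpoint-weights
                                                                (All.head near) (All.lookup near (there z∈)) (All.lookup x≢ z∈)) ⟩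
      2 * c z + 2 * k                                      ≡⟨ ℕP.*-distribˡ-+ 2 (c z) k ⟨
      2 * (c z + k)                                        ∎)
  ascending-span (_ ∷ []) _ _ _ (s≤s ())

  weight-sum≤span : ∀ xs → Unique xs → All Near xs → 2 ≤ length xs →
    ∃₂ λ x z → sum (map weight xs) + c x ≤ c z + k
  weight-sum≤span xs unique near 2≤length =
    let sorted↭xs = sort-↭ xs
        x , z , spread = ascending-span (sort xs) (sort-↗ xs)
          (SetoidPermutation.Unique-resp-↭ (setoid A) (↭⇒↭ₛ (↭-sym sorted↭xs)) unique)
          (All-resp-↭ (↭-sym sorted↭xs) near)
          (subst (2 ≤_) (sym (↭-length sorted↭xs)) 2≤length)
    in x , z , subst (λ s → s + c x ≤ c z + k) (sum-↭ (map⁺ weight sorted↭xs)) spread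
    where
    open Sort (On.decTotalOrder ℕP.≤-decTotalOrder c) using (sort; sort-↭; sort-↗)

total : ℕ → ℕ → ℕ → ℕ
total t Q K = K + 2 * ∑[ q < Q ] ∑[ r < t ] (K ∸ 2 * (q + residueCost t r))

module _ (t : ℕ) .{{_ : NonZero t}} where

  total≤span : ∀ {k c} → IsRadioLabeling t k c → 1 ≤ k → ∀ Q →
    ∃₂ λ x z → total t (suc Q) (suc k) + c x ≤ c z + k
  total≤span {k} {c} radio 1≤k Q =
    let x , z , spread = weight-sum≤span (filter near? vertices) (UniqueP.filter⁺ near? (ball-unique t N))
                              (all-filter near? vertices) two-near
    in x , z , subst (λ s → s + c x ≤ c z + k) total-weight spread
    where
    open Packing c (reach t) k (reach-separated t {c = c} radio) (reach-roots t)
    N = suc Q * t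
    vertices = ball t N
    two-near : 2 ≤ length (filter near? vertices)
    two-near = distinct-members⇒2≤length
      (∈-filter⁺ near? (∈-++⁺ˡ {ys = applyUpTo -[1+_] N} (∈-applyUpTo⁺ +_ {n = suc N} (s≤s z≤n))) z≤n)
      (∈-filter⁺ near? (∈-++⁺ˡ {ys = applyUpTo -[1+_] N} (∈-applyUpTo⁺ +_ {n = suc N} (s≤s (ℕP.≤-trans (ℕ.>-nonZero⁻¹ t) (ℕP.m≤m+n t (Q * t))))))
        (ℕP.≤-trans (ℕP.*-monoʳ-≤ 2 (reach-1≤1 t)) (s≤s 1≤k)))
      λ ()
    total-weight : sum (map weight (filter near? vertices)) ≡ total t (suc Q) (suc k)
    total-weight = trans (sum-filter-near vertices)
      (trans (sum-ball t (λ ℓ → suc k ∸ 2 * ℓ) N) (cong (λ s → suc k + 2 * s) (∑-reach-blocks t (suc Q) (λ ℓ → suc k ∸ 2 * ℓ))))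

total-step : ∀ t Q K → total t (suc Q) (2 + K) ≡ 2 + 2 * ∑[ r < t ] (2 + K ∸ 2 * residueCost t r) + total t Q K
total-step t Q K = trans (cong (λ R → 2 + K + 2 * (X + R)) rows) (regroup K X R)
  where
  X = ∑[ r < t ] (2 + K ∸ 2 * residueCost t r)
  R = ∑[ q < Q ] ∑[ r < t ] (K ∸ 2 * (q + residueCost t r))
  rows : ∑[ q < Q ] ∑[ r < t ] (2 + K ∸ 2 * (suc q + residueCost t r)) ≡ R
  rows = ∑-cong Q λ {q} _ → ∑-cong t λ {r} _ → cong (2 + K ∸_) (ℕP.*-suc 2 (q + residueCost t r))
  regroup : ∀ K X R → 2 + K + 2 * (X + R) ≡ 2 + 2 * X + (K + 2 * R)
  regroup = ℕ-Solver.solve-∀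

row-lower-bound : ∀ t W → t * W ≤ 2 * ∑[ r < t ] residueCost t r + ∑[ r < t ] (W ∸ 2 * residueCost t r)
row-lower-bound t W = begin
  t * W                                                              ≡⟨ ∑-const t W ⟨
  ∑[ r < t ] W                                                       ≤⟨ ∑-mono-≤ t (λ {r} _ → ℕP.m≤n+m∸n W (2 * residueCost t r)) ⟩
  ∑[ r < t ] (2 * residueCost t r + (W ∸ 2 * residueCost t r))      ≡⟨ ∑-+ t _ _ ⟩
  ∑[ r < t ] (2 * residueCost t r) + ∑[ r < t ] (W ∸ 2 * residueCost t r)
                                 ≡⟨ cong (_+ ∑[ r < t ] (W ∸ 2 * residueCost t r)) (∑-*ˡ t 2 (residueCost t)) ⟩
  2 * ∑[ r < t ] residueCost t r + ∑[ r < t ] (W ∸ 2 * residueCost t r) ∎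
  where open ℕP.≤-Reasoning

-- Inlined so that the ring solver sees the polynomial itself in bound-step and DiagonalSlack.
bound : ℤ → ℤ → ℤ
bound t k = + 4 ℤ.* t ℤ.* k ℤ.* k
  ℤ.- (+ 4 ℤ.* t ℤ.* t ℤ.- + 8 ℤ.* t ℤ.+ + 4) ℤ.* k
  ℤ.+ (t ℤ.* t ℤ.* t ℤ.- + 4 ℤ.* t ℤ.* t ℤ.+ + 6 ℤ.* t ℤ.- + 4)
{-# INLINE bound #-}

Attains : ℕ → ℕ → ℕ → Set
Attains t k Q = bound (+ t) (+ k) ℤ.≤ + 8 ℤ.* (+ total t Q (suc k) ℤ.- + k)

cross-subtract : ∀ a b c d → a + d ≤ b + c → + a ℤ.- + c ℤ.≤ + b ℤ.- + d
cross-subtract a b c d h = subst₂ ℤ._≤_ (cancel (+ a) (+ d) (+ c)) (swap-cancel (+ b) (+ c) (+ d))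
  (ℤP.+-monoˡ-≤ (ℤ.- (+ c ℤ.+ + d)) (ℤ.+≤+ h))
  where
  cancel : ∀ a d c → a ℤ.+ d ℤ.- (c ℤ.+ d) ≡ a ℤ.- c
  cancel = ℤ-Solver.solve-∀
  swap-cancel : ∀ b c d → b ℤ.+ c ℤ.- (c ℤ.+ d) ≡ b ℤ.- d
  swap-cancel = ℤ-Solver.solve-∀

step-gain : ∀ t k → 16 * (t * (3 + k)) + 0 ≤ 16 * ∑[ r < t ] (3 + k ∸ 2 * residueCost t r) + 8 * (suc t * suc t)
step-gain t k = begin
  16 * (t * (3 + k)) + 0             ≤⟨ ℕP.+-monoˡ-≤ 0 (ℕP.*-monoʳ-≤ 16 (row-lower-bound t (3 + k))) ⟩
  16 * (2 * S + X) + 0               ≡⟨ expand S X ⟩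
  16 * X + 8 * (4 * S)               ≤⟨ ℕP.+-monoʳ-≤ (16 * X) (ℕP.*-monoʳ-≤ 8 (∑-residueCost t)) ⟩
  16 * X + 8 * (suc t * suc t)       ∎
  where
  open ℕP.≤-Reasoning
  S = ∑[ r < t ] residueCost t r
  X = ∑[ r < t ] (3 + k ∸ 2 * residueCost t r)
  expand : ∀ S X → 16 * (2 * S + X) + 0 ≡ 16 * X + 8 * (4 * S)
  expand = ℕ-Solver.solve-∀

bound-step : ∀ t k → bound t (+ 2 ℤ.+ k) ≡
  bound t k ℤ.+ (+ 16 ℤ.* (t ℤ.* (+ 3 ℤ.+ k)) ℤ.- + 8 ℤ.* ((+ 1 ℤ.+ t) ℤ.* (+ 1 ℤ.+ t)))
bound-step = ℤ-Solver.solve-∀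

attains-step : ∀ t k Q → Attains t k Q → Attains t (2 + k) (suc Q)
attains-step t k Q attains = begin
  bound (+ t) (+ (2 + k))                                             ≡⟨ bound-step (+ t) (+ k) ⟩
  bound (+ t) (+ k) ℤ.+ (+ 16 ℤ.* (+ t ℤ.* + (3 + k)) ℤ.- + (8 * (suc t * suc t)))
                                                                      ≡⟨ cong (λ a → bound (+ t) (+ k) ℤ.+ (+ 16 ℤ.* a ℤ.- + (8 * (suc t * suc t)))) (ℤP.pos-* t (3 + k)) ⟨
  bound (+ t) (+ k) ℤ.+ (+ 16 ℤ.* + (t * (3 + k)) ℤ.- + (8 * (suc t * suc t)))
                                                                      ≡⟨ cong (λ a → bound (+ t) (+ k) ℤ.+ (a ℤ.- + (8 * (suc t * suc t)))) (ℤP.pos-* 16 (t * (3 + k))) ⟨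
  bound (+ t) (+ k) ℤ.+ (+ (16 * (t * (3 + k))) ℤ.- + (8 * (suc t * suc t)))
                                                                      ≤⟨ ℤP.+-mono-≤ attains (cross-subtract (16 * (t * (3 + k))) (16 * X) (8 * (suc t * suc t)) 0 (step-gain t k)) ⟩
  + 8 ℤ.* (+ T ℤ.- + k) ℤ.+ (+ (16 * X) ℤ.- + 0)                      ≡⟨ cong (λ a → + 8 ℤ.* (+ T ℤ.- + k) ℤ.+ (a ℤ.- + 0)) (ℤP.pos-* 16 X) ⟩
  + 8 ℤ.* (+ T ℤ.- + k) ℤ.+ (+ 16 ℤ.* + X ℤ.- + 0)                    ≡⟨ regroup (+ T) (+ k) (+ X) ⟩
  + 8 ℤ.* (+ 2 ℤ.+ + 2 ℤ.* + X ℤ.+ + T ℤ.- + (2 + k))                 ≡⟨ cong (λ a → + 8 ℤ.* (+ 2 ℤ.+ a ℤ.+ + T ℤ.- + (2 + k))) (ℤP.pos-* 2 X) ⟨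
  + 8 ℤ.* (+ (2 + 2 * X + T) ℤ.- + (2 + k))                          ≡⟨ cong (λ a → + 8 ℤ.* (+ a ℤ.- + (2 + k))) (total-step t Q (suc k)) ⟨
  + 8 ℤ.* (+ total t (suc Q) (suc (2 + k)) ℤ.- + (2 + k))             ∎
  where
  open ℤP.≤-Reasoning
  T = total t Q (suc k)
  X = ∑[ r < t ] (3 + k ∸ 2 * residueCost t r)
  regroup : ∀ T k X → + 8 ℤ.* (T ℤ.- k) ℤ.+ (+ 16 ℤ.* X ℤ.- + 0) ≡ + 8 ℤ.* (+ 2 ℤ.+ + 2 ℤ.* X ℤ.+ T ℤ.- (+ 2 ℤ.+ k))
  regroup = ℤ-Solver.solve-∀

≤-by-slack : ∀ {x y} a b n → x ℤ.+ (+ a ℤ.+ + b ℤ.* + n) ≡ y → x ℤ.≤ y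
≤-by-slack {x} a b n eq = subst (x ℤ.≤_) eq
  (subst (λ s → x ℤ.≤ x ℤ.+ (+ a ℤ.+ s)) (ℤP.pos-* b n) (ℤP.i≤i+j x (+ (a + b * n))))

DiagonalSlack : ℕ → ℕ → ℕ → Set
DiagonalSlack j a b = ∀ K → bound (+ 2 ℤ.* (+ 1 ℤ.+ K) ℤ.+ + j) (+ 1 ℤ.+ K) ℤ.+ (+ a ℤ.+ + b ℤ.* K) ≡ + 8 ℤ.* (+ 1 ℤ.+ + 2 ℤ.* K)
{-# INLINE DiagonalSlack #-}

diagonal-bound : ∀ j a b k → DiagonalSlack j a b → bound (+ (2 * suc k + j)) (+ suc k) ℤ.≤ + 8 ℤ.* + (1 + 2 * k)
diagonal-bound j a b k slack = ≤-by-slack a b k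
  (trans (slack (+ k)) (cong (λ s → + 8 ℤ.* (+ 1 ℤ.+ s)) (sym (ℤP.pos-* 2 k))))

-- On t = 2k + j the bound is 2 (j − 2)² k + bound j 0, linear in k.
bound-near-diagonal : ∀ j k → j ≤ 3 → 3 ≤ 2 * k + j → bound (+ (2 * k + j)) (+ k) ℤ.≤ + 8 ℤ.* + (1 + 2 * (k ∸ 1))
bound-near-diagonal 3 zero _ _ = ℤ.+≤+ (ℕP.m≤m+n 5 3)
bound-near-diagonal 0 (suc k) _ _ = diagonal-bound 0 4 8 k ℤ-Solver.solve-∀
bound-near-diagonal 1 (suc k) _ _ = diagonal-bound 1 7 14 k ℤ-Solver.solve-∀
bound-near-diagonal 2 (suc k) _ _ = diagonal-bound 2 8 16 k ℤ-Solver.solve-∀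
bound-near-diagonal 3 (suc k) _ _ = diagonal-bound 3 1 14 k ℤ-Solver.solve-∀
bound-near-diagonal 1 zero _ (s≤s ())
bound-near-diagonal 2 zero _ (s≤s (s≤s ()))
bound-near-diagonal (suc (suc (suc (suc _)))) _ (s≤s (s≤s (s≤s ()))) _

attains-one-row : ∀ t k → bound (+ suc t) (+ k) ℤ.≤ + 8 ℤ.* + (1 + 2 * (k ∸ 1)) → Attains (suc t) k 1
attains-one-row t k diagonal = ℤP.≤-trans diagonal (ℤP.*-monoˡ-≤-nonNeg (+ 8)
  (subst (ℤ._≤ + T ℤ.- + k) (ℤP.+-identityʳ (+ (1 + y)))
    (cross-subtract (1 + y) T 0 k (subst (_≤ T + 0) (cong suc (ℕP.+-comm k y)) first-row))))
  where
  y = 2 * (k ∸ 1)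
  T = total (suc t) 1 (suc k)
  first-row : suc k + y ≤ T + 0
  first-row = ℕP.≤-trans
    (ℕP.+-monoʳ-≤ (suc k) (ℕP.*-monoʳ-≤ 2 (ℕP.≤-trans (ℕP.m≤m+n (k ∸ 1) _) (ℕP.m≤m+n _ 0))))
    (ℕP.m≤m+n T 0)

attains-base : ∀ t k → 2 * k ≤ t → t ≤ 2 * k + 3 → 3 ≤ t → Attains t k 1
attains-base (suc t) k 2k≤t t≤2k+3 3≤t = attains-one-row t k
  (subst (λ s → bound (+ s) (+ k) ℤ.≤ + 8 ℤ.* + (1 + 2 * (k ∸ 1))) (ℕP.m+[n∸m]≡n 2k≤t)
    (bound-near-diagonal (suc t ∸ 2 * k) k (ℕP.m≤n+o⇒m∸n≤o (suc t) (2 * k) t≤2k+3)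
      (subst (3 ≤_) (sym (ℕP.m+[n∸m]≡n 2k≤t)) 3≤t)))

attains : ∀ t k → 3 ≤ t → t ≤ 2 * k + 3 → ∃[ Q ] Attains t k (suc Q)
attains t zero 3≤t t≤3 = 0 , attains-base t 0 z≤n t≤3 3≤t
attains t (suc zero) 3≤t t≤5 = 0 , attains-base t 1 (ℕP.≤-trans (ℕP.n≤1+n 2) 3≤t) t≤5 3≤t
attains t (suc (suc k)) 3≤t t≤2k+7 with 2 * suc (suc k) ℕ.≤? t
... | yes 2k≤t = 0 , attains-base t (2 + k) 2k≤t t≤2k+7 3≤t
... | no 2k≰t =
  let Q , attains-k = attains t k 3≤t (ℕP.≤-pred (subst (suc t ≤_) (double k) (ℕP.≰⇒> 2k≰t)))
  in suc Q , attains-step t k (suc Q) attains-k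
  where
  double : ∀ k → 2 * suc (suc k) ≡ suc (2 * k + 3)
  double = ℕ-Solver.solve-∀

proposition2 : (t k : ℕ) → 3 ≤ t → t ≤ 2 * k →
    (c : ℤ → ℕ) → IsRadioLabeling t k c →
    ∃₂ λ x y →
      ((+ 4) ℤ.* (+ t) ℤ.* (+ k) ℤ.* (+ k)
        ℤ.- ((+ 4) ℤ.* (+ t) ℤ.* (+ t) ℤ.- (+ 8) ℤ.* (+ t) ℤ.+ (+ 4)) ℤ.* (+ k)
        ℤ.+ ((+ t) ℤ.* (+ t) ℤ.* (+ t) ℤ.- (+ 4) ℤ.* (+ t) ℤ.* (+ t) ℤ.+ (+ 6) ℤ.* (+ t) ℤ.- (+ 4)))
      ℤ.≤ (+ 8) ℤ.* ((+ c x) ℤ.- (+ c y))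
proposition2 (suc t) zero 3≤t () c radio
proposition2 (suc t) (suc k) 3≤t t≤2k c radio =
  let Q , attains-k = attains (suc t) (suc k) 3≤t (ℕP.≤-trans t≤2k (ℕP.m≤m+n (2 * suc k) 3))
      x , z , spread = total≤span (suc t) {c = c} radio (s≤s z≤n) Q
  in z , x , ℤP.≤-trans attains-k (ℤP.*-monoˡ-≤-nonNeg (+ 8) (cross-subtract (total (suc t) (suc Q) (suc (suc k))) (c z) (suc k) (c x) spread))
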